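{- Let $(G,k)$ be an instance of Paw-free Edge Deletion, and let $M$ be the set of all vertices of the paws in a maximal family of pairwise edge-disjoint induced paws of $G$. Let $G^*$ be obtained from $G$ by deleting, from each part of each connected component of $G-M$ that is a complete multipartite graph, all but $k+1$ of its vertices (parts with at most $k+1$ vertices are left unchanged). Then $(G,k)$ is a yes-instance if and only if $(G^*,k)$ is a yes-instance.
   Context: All graphs are finite, simple and undirected. A paw is the four-vertex graph consisting of a triangle together with one additional vertex adjacent to exactly one vertex of the triangle; a graph is paw-free if it has no induced paw. Paw-free Edge Deletion: given a graph $G$ and an integer $k\ge 0$, decide whether there is $E_-\subseteq E(G)$ with $|E_-|\le k$ such that $G-E_-$ is paw-free. A family of induced paws is pairwise edge-disjoint if no edge of $G$ belongs to two of them; it is maximal if no further induced paw of $G$ can be added. A complete multipartite graph is a graph whose vertex set can be partitioned into $p\ge 3$ independent sets (parts) with every pair of vertices from different parts adjacent. -}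

module Defs where

open import Data.Nat using (ℕ; suc; _≤_; _<_)
open import Data.Fin using (Fin)
open import Data.Bool using (Bool; T)
open import Data.List using (List; []; _∷_; length)
open import Data.List.Membership.Propositional using (_∈_; _∉_)
open import Data.List.Relation.Unary.Any using (Any)
open import Data.List.Relation.Unary.All using (All)
open import Data.List.Relation.Unary.AllPairs using (AllPairs)
open import Data.List.Relation.Unary.Unique.Propositional using (Unique)
open import Data.Product using (Σ; Σ-syntax; ∃; _×_; _,_; proj₁)
open import Data.Sum using (_⊎_)
open import Relation.Nullary using (¬_)
open import Relation.Binary.PropositionalEquality using (_≡_; _≢_)
open import Relation.Binary.Construct.Closure.ReflexiveTransitive using (Star)

record Graph (V : Set) : Set₁ where
  field
    Adj   : V → V → Set
    sym   : ∀ {x y} → Adj x y → Adj y x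
    irrefl : ∀ x → ¬ Adj x x
open Graph public

IsInducedPaw : {V : Set} → (V → V → Set) → V → V → V → V → Set
IsInducedPaw R a b c d =
  (a ≢ b) × (a ≢ c) × (a ≢ d) × (b ≢ c) × (b ≢ d) × (c ≢ d) ×
  R a b × R b c × R a c × R a d × ¬ R b d × ¬ R c d

PawFree : {V : Set} → (V → V → Set) → Set
PawFree {V} R = ∀ (a b c d : V) → ¬ IsInducedPaw R a b c d

-- G - E⁻, where E⁻ is given as a list of (ordered representatives of) edges.
DeleteEdges : {V : Set} → Graph V → List (V × V) → V → V → Set
DeleteEdges G E x y = Adj G x y × (x , y) ∉ E × (y , x) ∉ E

YesInstance : {V : Set} → Graph V → ℕ → Set
YesInstance {V} G k =
  Σ[ E ∈ List (V × V) ]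
    All (λ e → Adj G (proj₁ e) (Data.Product.proj₂ e)) E ×
    length E ≤ k × PawFree (DeleteEdges G E)

Induced : {V : Set} → Graph V → (S : V → Bool) → Graph (Σ V (λ v → T (S v)))
Induced G S = record
  { Adj = λ x y → Adj G (proj₁ x) (proj₁ y)
  ; sym = sym G
  ; irrefl = λ x → irrefl G (proj₁ x) }

record Paw {n : ℕ} (G : Graph (Fin n)) : Set where
  constructor paw
  field
    pa pb pc pd : Fin n
    isPaw : IsInducedPaw (Adj G) pa pb pc pd
open Paw public

pawEdges : {n : ℕ} {G : Graph (Fin n)} → Paw G → List (Fin n × Fin n)
pawEdges P = (pa P , pb P) ∷ (pb P , pc P) ∷ (pa P , pc P) ∷ (pa P , pd P) ∷ []

pawVertices : {n : ℕ} {G : Graph (Fin n)} → Paw G → List (Fin n)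
pawVertices P = pa P ∷ pb P ∷ pc P ∷ pd P ∷ []

SameEdge : {V : Set} → V × V → V × V → Set
SameEdge (x , y) (x' , y') = (x ≡ x' × y ≡ y') ⊎ (x ≡ y' × y ≡ x')

ShareEdge : {n : ℕ} {G : Graph (Fin n)} → Paw G → Paw G → Set
ShareEdge P Q = Any (λ e → Any (SameEdge e) (pawEdges Q)) (pawEdges P)

PairwiseEdgeDisjoint : {n : ℕ} {G : Graph (Fin n)} → List (Paw G) → Set
PairwiseEdgeDisjoint F = AllPairs (λ P Q → ¬ ShareEdge P Q) F

MaximalFamily : {n : ℕ} (G : Graph (Fin n)) → List (Paw G) → Set
MaximalFamily G F = ∀ (P : Paw G) → Any (ShareEdge P) F

InM : {n : ℕ} {G : Graph (Fin n)} → List (Paw G) → Fin n → Set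
InM F v = Any (λ P → v ∈ pawVertices P) F

EdgeOutsideM : {n : ℕ} (G : Graph (Fin n)) → (Fin n → Set) → Fin n → Fin n → Set
EdgeOutsideM G M x y = ¬ M x × ¬ M y × Adj G x y

Component : {n : ℕ} (G : Graph (Fin n)) → (Fin n → Set) → Fin n → Fin n → Set
Component G M v w = ¬ M w × Star (EdgeOutsideM G M) v w

IsCompleteMultipartiteOn : {n : ℕ} → Graph (Fin n) → (Fin n → Set) → Set
IsCompleteMultipartiteOn {n} G C =
  Σ[ p ∈ ℕ ] 3 ≤ p × Σ[ f ∈ (Fin n → Fin p) ]
    (∀ i → ∃ λ w → C w × f w ≡ i) ×
    (∀ x y → C x → C y → (Adj G x y → f x ≢ f y) × (f x ≢ f y → Adj G x y))

-- The part of v inside its (complete multipartite) component: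
-- vertices of the component equal or non-adjacent to v.
Part : {n : ℕ} (G : Graph (Fin n)) → (Fin n → Set) → Fin n → Fin n → Set
Part G M v w = Component G M v w × ¬ Adj G v w

HasSize : {n : ℕ} → (Fin n → Set) → ℕ → Set
HasSize {n} P m =
  Σ[ xs ∈ List (Fin n) ] Unique xs × length xs ≡ m ×
    (∀ x → (x ∈ xs → P x) × (P x → x ∈ xs))

-- S selects the vertex set of G*: all of M, all vertices of non-complete-multipartite
-- components of G - M, and from each part of each complete multipartite component
-- either the whole part (if it has ≤ k+1 vertices) or exactly k+1 of its vertices.
IsReduction : {n : ℕ} (G : Graph (Fin n)) → ℕ → List (Paw G) → (Fin n → Bool) → Set
IsReduction G k F S =
  (∀ v → InM F v → T (S v)) ×
  (∀ v → ¬ InM F v → ¬ IsCompleteMultipartiteOn G (Component G (InM F) v) → T (S v)) ×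
  (∀ v → ¬ InM F v → IsCompleteMultipartiteOn G (Component G (InM F) v) →
     ∀ m → HasSize (Part G (InM F) v) m →
       (m ≤ suc k → ∀ w → Part G (InM F) v w → T (S w)) ×
       (suc k < m → HasSize (λ w → Part G (InM F) v w × T (S w)) (suc k)))

module Submission where

-- Every induced paw of G shares an edge with a paw of the maximal family, so its apex a or
-- the triangle vertex b lies in M. Consequently, in a complete multipartite component of G − M,
-- two vertices u, v of one part are false twins in G: a vertex w ∈ M adjacent to u but not to v
-- would span, with vertices from two further parts, a paw having a and b outside M.
-- A solution E of G* has at most k edges, and each edge meets an independent set at most once,
-- so among the k + 1 kept vertices of a large part one is untouched by E; it is a false twin in
-- G − E of every deleted vertex of that part. Replacing the vertices of a paw of G − E one at a
-- time by such twins yields a paw of G* − E. Conversely, a solution of G restricts to G*.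
-- Adjacency is not decidable, so the twin arguments hold only under double negation; this
-- suffices because paw-freeness is a negative statement.

open import Defs
open import Agda.Primitive using (lzero)
open import Data.Bool using (Bool; T; T?)
open import Data.Bool.Properties using (T-irrelevant)
open import Data.Empty using (⊥; ⊥-elim)
open import Data.Fin using (Fin; zero; suc)
import Data.Fin as Fin
open import Data.Fin.Properties using (pigeonhole; <⇒≢)
open import Data.List using (List; []; _∷_; length; lookup; map; filter; allFin)
open import Data.List.Properties using (length-map)
open import Data.List.Membership.Propositional using (_∈_; find)
open import Data.List.Membership.Propositional.Properties
  using (∈-lookup; ∈-map⁺; ∈-map⁻; ∈-filter⁺; ∈-filter⁻; ∈-allFin)
open import Data.List.Relation.Unary.All using (All; []; _∷_)
import Data.List.Relation.Unary.All as All
open import Data.List.Relation.Unary.All.Properties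
  using (¬All⇒Any¬; All¬⇒¬Any) renaming (map⁺ to All-map⁺)
open import Data.List.Relation.Unary.AllPairs using (_∷_)
open import Data.List.Relation.Unary.Any using (Any; here; there; any?)
import Data.List.Relation.Unary.Any as Any
open import Data.List.Relation.Unary.Any.Properties using (lookup-index) renaming (map⁻ to Any-map⁻)
open import Data.List.Relation.Unary.Unique.Propositional using (Unique)
open import Data.List.Relation.Unary.Unique.Propositional.Properties using (allFin⁺; filter⁺)
import Data.Nat as ℕ
open import Data.Nat using (ℕ; suc; s≤s; _≤_; _<_; _≤?_)
open import Data.Nat.Properties using (m≤n⇒m≤1+n; ≰⇒>; ≤-trans)
open import Data.Product using (Σ; ∃; ∃₂; ∃-syntax; _×_; _,_; proj₁; proj₂; swap)
open import Data.Sum using (_⊎_; inj₁; inj₂)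
open import Effect.Monad using (RawMonad)
open import Function using (_∘_; id; _⇔_; mk⇔; Equivalence)
open import Relation.Binary.Construct.Closure.ReflexiveTransitive using (ε; _◅_; _◅◅_)
open import Relation.Binary.Definitions using (DecidableEquality)
open import Relation.Binary.PropositionalEquality
  using (_≡_; _≢_; refl; cong; cong₂; subst; trans; ≢-sym)
import Relation.Binary.PropositionalEquality as ≡
open import Relation.Nullary using (¬_; Dec; yes; no)
open import Relation.Nullary.Decidable using (¬¬-excluded-middle; decidable-stable; _⊎-dec_)
open import Relation.Nullary.Negation using (¬¬-map; contradiction; ¬¬-Monad)
open import Relation.Unary using (Decidable)

variable
  V W I : Set

infix 3 _⇔¬¬_
_⇔¬¬_ : Set → Set → Set
A ⇔¬¬ B = (A → ¬ ¬ B) × (B → ¬ ¬ A)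

⇔¬¬-refl : {A : Set} → A ⇔¬¬ A
⇔¬¬-refl = contradiction , contradiction

adj⇒≢ : (H : Graph V) {u v : V} → Adj H u v → u ≢ v
adj⇒≢ H uv refl = irrefl H _ uv

induced-paw : (H : Graph V) {a b c d : V} →
              Adj H a b → Adj H b c → Adj H a c → Adj H a d → ¬ Adj H b d → ¬ Adj H c d →
              IsInducedPaw (Adj H) a b c d
induced-paw H ab bc ac ad ¬bd ¬cd =
  adj⇒≢ H ab , adj⇒≢ H ac , adj⇒≢ H ad , adj⇒≢ H bc ,
  (λ { refl → ¬cd (sym H bc) }) , (λ { refl → ¬bd bc }) ,
  ab , bc , ac , ad , ¬bd , ¬cd

paw-transfer : (H : Graph V) (H' : Graph W) (f : I → V) (g : I → W) →
               (∀ i j → Adj H (f i) (f j) ⇔¬¬ Adj H' (g i) (g j)) →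
               ∀ {a b c d} → IsInducedPaw (Adj H) (f a) (f b) (f c) (f d) →
               ¬ ¬ IsInducedPaw (Adj H') (g a) (g b) (g c) (g d)
paw-transfer H H' f g adj {a} {b} {c} {d}
             (_ , _ , _ , _ , _ , _ , ab , bc , ac , ad , ¬bd , ¬cd) ¬paw' =
  proj₁ (adj a b) ab λ ab' → proj₁ (adj b c) bc λ bc' →
  proj₁ (adj a c) ac λ ac' → proj₁ (adj a d) ad λ ad' →
  ¬paw' (induced-paw H' ab' bc' ac' ad'
          (λ bd' → proj₂ (adj b d) bd' ¬bd) (λ cd' → proj₂ (adj c d) cd' ¬cd))

Twins : Graph V → V → V → Set
Twins H x x' = ∀ w → Adj H x w ⇔¬¬ Adj H x' w

twins-refl : (H : Graph V) {x : V} → Twins H x x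
twins-refl H w = ⇔¬¬-refl

module Redirect {V : Set} (_≟_ : DecidableEquality V) (x x' : V) where

  redirect : V → V
  redirect v with v ≟ x
  ... | yes _ = x'
  ... | no _ = v

  redirect-hit : redirect x ≡ x'
  redirect-hit with x ≟ x
  ... | yes _ = refl
  ... | no x≢x = ⊥-elim (x≢x refl)

  redirect-preserves : (P : V → Set) → P x' → ∀ {v} → P v → P (redirect v)
  redirect-preserves P px' {v} pv with v ≟ x
  ... | yes _ = px'
  ... | no _ = pv

  redirect-adj : (H : Graph V) → Twins H x x' →
                 ∀ u v → Adj H u v ⇔¬¬ Adj H (redirect u) (redirect v)
  redirect-adj H twins u v with u ≟ x | v ≟ x
  ... | yes refl | yes refl = ⊥-elim ∘ irrefl H u , ⊥-elim ∘ irrefl H x'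
  ... | yes refl | no _ = twins v
  ... | no _ | yes refl = (λ ux → ¬¬-map (sym H) (proj₁ (twins u) (sym H ux))) ,
                          (λ ux' → ¬¬-map (sym H) (proj₂ (twins u) (sym H ux')))
  ... | no _ | no _ = ⇔¬¬-refl

module _ {V : Set} (_≟_ : DecidableEquality V) (H : Graph V) (Keep : V → Set)
         (kept-twin : ∀ x → ¬ ¬ (∃[ x' ] Keep x' × Twins H x x')) where

  private
    keep-vertex : ∀ x {a b c d} → IsInducedPaw (Adj H) a b c d →
                  ¬ ¬ (∃[ φ ] Keep (φ x) × (∀ {v} → Keep v → Keep (φ v)) ×
                             IsInducedPaw (Adj H) (φ a) (φ b) (φ c) (φ d))
    keep-vertex x p ¬kept = kept-twin x λ (x' , kx' , twins) →
      let open Redirect _≟_ x x' in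
      paw-transfer H H id redirect (redirect-adj H twins) p λ p' →
      ¬kept (redirect , subst Keep (≡.sym redirect-hit) kx' , redirect-preserves Keep kx' , p')

  pawFree-from-kept-twins :
    (∀ a b c d → Keep a → Keep b → Keep c → Keep d → ¬ IsInducedPaw (Adj H) a b c d) →
    PawFree (Adj H)
  pawFree-from-kept-twins kept-pawFree a b c d p =
    keep-vertex a p λ (φ₁ , ka , keep₁ , p₁) →
    keep-vertex (φ₁ b) p₁ λ (φ₂ , kb , keep₂ , p₂) →
    keep-vertex (φ₂ (φ₁ c)) p₂ λ (φ₃ , kc , keep₃ , p₃) →
    keep-vertex (φ₃ (φ₂ (φ₁ d))) p₃ λ (φ₄ , kd , keep₄ , p₄) →
    kept-pawFree _ _ _ _ (keep₄ (keep₃ (keep₂ ka))) (keep₄ (keep₃ kb)) (keep₄ kc) kd p₄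

_∖_ : Graph V → List (V × V) → Graph V
G ∖ E = record
  { Adj = DeleteEdges G E
  ; sym = λ (uv , uv∉E , vu∉E) → sym G uv , vu∉E , uv∉E
  ; irrefl = λ x → irrefl G x ∘ proj₁ }

Edges : Graph V → List (V × V) → Set
Edges H = All (λ e → Adj H (proj₁ e) (proj₂ e))

Touches : V → V × V → Set
Touches y (s , t) = y ≡ s ⊎ y ≡ t

Touched : List (V × V) → V → Set
Touched E y = Any (Touches y) E

touched? : DecidableEquality V → (E : List (V × V)) → Decidable (Touched E)
touched? _≟_ E y = any? (λ (s , t) → (y ≟ s) ⊎-dec (y ≟ t)) E

untouched-adj : (G : Graph V) (E : List (V × V)) {u w : V} →
                ¬ Touched E u → Adj G u w → Adj (G ∖ E) u w
untouched-adj G E ¬tu uw =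
  uw , ¬tu ∘ Any.map (inj₁ ∘ cong proj₁) , ¬tu ∘ Any.map (inj₂ ∘ cong proj₂)

untouched-twins : (G : Graph V) (E : List (V × V)) {x x' : V} →
                  ¬ Touched E x → ¬ Touched E x' → Twins G x x' → Twins (G ∖ E) x x'
untouched-twins G E ¬tx ¬tx' twins w =
  (λ xw → ¬¬-map (untouched-adj G E ¬tx') (proj₁ (twins w) (proj₁ xw))) ,
  (λ x'w → ¬¬-map (untouched-adj G E ¬tx) (proj₂ (twins w) (proj₁ x'w)))

edge-touches-once : (H : Graph V) {e : V × V} {y z : V} → Adj H (proj₁ e) (proj₂ e) →
                    ¬ Adj H y z → Touches y e → Touches z e → y ≡ z
edge-touches-once H st ¬yz (inj₁ refl) (inj₁ refl) = refl
edge-touches-once H st ¬yz (inj₁ refl) (inj₂ refl) = ⊥-elim (¬yz st)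
edge-touches-once H st ¬yz (inj₂ refl) (inj₁ refl) = ⊥-elim (¬yz (sym H st))
edge-touches-once H st ¬yz (inj₂ refl) (inj₂ refl) = refl

unique-lookup-injective : {xs : List V} → Unique xs → ∀ {i j} → lookup xs i ≡ lookup xs j → i ≡ j
unique-lookup-injective (_ ∷ _) {zero} {zero} _ = refl
unique-lookup-injective (x∉xs ∷ _) {zero} {suc j} eq = ⊥-elim (All.lookup x∉xs (∈-lookup j) eq)
unique-lookup-injective (x∉xs ∷ _) {suc i} {zero} eq =
  ⊥-elim (All.lookup x∉xs (∈-lookup i) (≡.sym eq))
unique-lookup-injective (_ ∷ uniq) {suc i} {suc j} eq = cong suc (unique-lookup-injective uniq eq)

independent-set-has-untouched :
  DecidableEquality V → (H : Graph V) {E : List (V × V)} {L : List V} → Edges H E → Unique L →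
  (∀ {y z} → y ∈ L → z ∈ L → ¬ Adj H y z) → length E < length L → Any (¬_ ∘ Touched E) L
independent-set-has-untouched _≟_ H {E} {L} edges uniq independent |E|<|L| =
  ¬All⇒Any¬ (touched? _≟_ E) L all-touched⇒⊥
  where
  all-touched⇒⊥ : ¬ All (Touched E) L
  all-touched⇒⊥ all-touched = collision (pigeonhole |E|<|L| (Any.index ∘ touching))
    where
    touching : ∀ i → Touched E (lookup L i)
    touching i = All.lookup all-touched (∈-lookup i)

    collision : ∃₂ (λ i j → i Fin.< j × Any.index (touching i) ≡ Any.index (touching j)) → ⊥
    collision (i , j , i<j , same-edge) =
      <⇒≢ i<j (unique-lookup-injective uniq
        (edge-touches-once H (All.lookup edges (∈-lookup _))
          (independent (∈-lookup i) (∈-lookup j))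
          (lookup-index (touching i))
          (subst (Touches _ ∘ lookup E) (≡.sym same-edge) (lookup-index (touching j)))))

open RawMonad (¬¬-Monad {lzero})

¬¬-decidable : ∀ n (P : Fin n → Set) → ¬ ¬ (∀ x → Dec (P x))
¬¬-decidable ℕ.zero P = pure λ ()
¬¬-decidable (suc n) P = do
  P₀? ← ¬¬-excluded-middle
  P₊? ← ¬¬-decidable n (P ∘ suc)
  pure λ { zero → P₀? ; (suc i) → P₊? i }

¬¬-hasSize : ∀ {n} (P : Fin n → Set) → ¬ ¬ ∃ (HasSize P)
¬¬-hasSize {n} P = do
  P? ← ¬¬-decidable n P
  pure (_ , filter P? (allFin n) , filter⁺ P? (allFin⁺ n) , refl ,
        λ x → proj₂ ∘ ∈-filter⁻ P? {xs = allFin n} , ∈-filter⁺ P? (∈-allFin x))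

module _ {V : Set} (G : Graph V) (S : V → Bool) where

  private
    V* : Set
    V* = Σ V (T ∘ S)

    kept-≡ : {u w : V*} → proj₁ u ≡ proj₁ w → u ≡ w
    kept-≡ {u , su} refl = cong (u ,_) (T-irrelevant su _)

  AgreeOnKept : List (V* × V*) → List (V × V) → Set
  AgreeOnKept E* E = ∀ {u w : V*} → (u , w) ∈ E* ⇔ (proj₁ u , proj₁ w) ∈ E

  module _ {E* : List (V* × V*)} {E : List (V × V)} (agree : AgreeOnKept E* E) where
    open Equivalence

    induced-∖-adj : ∀ u w → Adj (Induced G S ∖ E*) u w ⇔¬¬ Adj (G ∖ E) (proj₁ u) (proj₁ w)
    induced-∖-adj u w =
      (λ (uw , uw∉E* , wu∉E*) → contradiction (uw , uw∉E* ∘ from agree , wu∉E* ∘ from agree)) ,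
      (λ (uw , uw∉E , wu∉E) → contradiction (uw , uw∉E ∘ to agree , wu∉E ∘ to agree))

    agreeOnKept-edges : Edges G E → Edges (Induced G S) E*
    agreeOnKept-edges edges = All.tabulate λ uw∈E* → All.lookup edges (to agree uw∈E*)

  restrict : List (V × V) → List (V* × V*)
  restrict [] = []
  restrict ((u , w) ∷ E) with T? (S u) | T? (S w)
  ... | yes su | yes sw = ((u , su) , (w , sw)) ∷ restrict E
  ... | _ | _ = restrict E

  restrict-length : ∀ E → length (restrict E) ≤ length E
  restrict-length [] = ℕ.z≤n
  restrict-length ((u , w) ∷ E) with T? (S u) | T? (S w)
  ... | yes _ | yes _ = s≤s (restrict-length E)
  ... | yes _ | no _ = m≤n⇒m≤1+n (restrict-length E)
  ... | no _ | _ = m≤n⇒m≤1+n (restrict-length E)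

  restrict-agrees : ∀ E → AgreeOnKept (restrict E) E
  restrict-agrees E = mk⇔ (to E) (from E)
    where
    to : ∀ E {u w} → (u , w) ∈ restrict E → (proj₁ u , proj₁ w) ∈ E
    to ((u , w) ∷ E) uw∈ with T? (S u) | T? (S w) | uw∈
    ... | yes _ | yes _ | here refl = here refl
    ... | yes _ | yes _ | there uw∈' = there (to E uw∈')
    ... | yes _ | no _ | uw∈' = there (to E uw∈')
    ... | no _ | _ | uw∈' = there (to E uw∈')

    from : ∀ E {u w} → (proj₁ u , proj₁ w) ∈ E → (u , w) ∈ restrict E
    from ((u , w) ∷ E) {_ , su'} {_ , sw'} uw∈ with T? (S u) | T? (S w) | uw∈
    ... | yes _ | yes _ | here refl = here (cong₂ _,_ (kept-≡ refl) (kept-≡ refl))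
    ... | yes _ | yes _ | there uw∈' = there (from E uw∈')
    ... | yes _ | no ¬sw | here refl = ⊥-elim (¬sw sw')
    ... | yes _ | no _ | there uw∈' = from E uw∈'
    ... | no ¬su | _ | here refl = ⊥-elim (¬su su')
    ... | no _ | _ | there uw∈' = from E uw∈'

  embedEdge : V* × V* → V × V
  embedEdge ((u , _) , (w , _)) = u , w

  embed : List (V* × V*) → List (V × V)
  embed = map embedEdge

  embedEdge-injective : ∀ {e e'} → embedEdge e ≡ embedEdge e' → e ≡ e'
  embedEdge-injective refl = cong₂ _,_ (kept-≡ refl) (kept-≡ refl)

  embed-agrees : ∀ E* → AgreeOnKept E* (embed E*)
  embed-agrees E* = mk⇔ (∈-map⁺ embedEdge) from
    where
    from : ∀ {u w} → (proj₁ u , proj₁ w) ∈ embed E* → (u , w) ∈ E*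
    from uw∈ with ∈-map⁻ embedEdge uw∈
    ... | _ , e∈E* , same = subst (_∈ E*) (≡.sym (embedEdge-injective same)) e∈E*

  embed-touched-kept : ∀ E* {y} → Touched (embed E*) y → T (S y)
  embed-touched-kept E* touched with Any.satisfied (Any-map⁻ touched)
  ... | ((_ , su) , _) , inj₁ refl = su
  ... | (_ , (_ , sw)) , inj₂ refl = sw

two-others : ∀ {p} → 3 ≤ p → (i : Fin p) → ∃₂ λ j l → i ≢ j × i ≢ l × j ≢ l
two-others (s≤s (s≤s (s≤s _))) zero = suc zero , suc (suc zero) , (λ ()) , (λ ()) , (λ ())
two-others (s≤s (s≤s (s≤s _))) (suc zero) = zero , suc (suc zero) , (λ ()) , (λ ()) , (λ ())
two-others (s≤s (s≤s (s≤s _))) (suc (suc _)) = zero , suc zero , (λ ()) , (λ ()) , (λ ())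

module _ {n : ℕ} {G : Graph (Fin n)} where

  edge-vertices : (Q : Paw G) {s t : Fin n} → (s , t) ∈ pawEdges Q →
                  s ∈ pawVertices Q × t ∈ pawVertices Q
  edge-vertices Q (here refl) = here refl , there (here refl)
  edge-vertices Q (there (here refl)) = there (here refl) , there (there (here refl))
  edge-vertices Q (there (there (here refl))) = here refl , there (there (here refl))
  edge-vertices Q (there (there (there (here refl)))) = here refl , there (there (there (here refl)))

  shared-edge-vertices : (Q : Paw G) {e : Fin n × Fin n} → Any (SameEdge e) (pawEdges Q) →
                         proj₁ e ∈ pawVertices Q × proj₂ e ∈ pawVertices Q
  shared-edge-vertices Q shared with find shared
  ... | _ , st∈Q , inj₁ (refl , refl) = edge-vertices Q st∈Q
  ... | _ , ts∈Q , inj₂ (refl , refl) = swap (edge-vertices Q ts∈Q)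

  shared-edge-in-M : (P : Paw G) {F : List (Paw G)} → Any (ShareEdge P) F →
                     Any (λ e → InM F (proj₁ e) × InM F (proj₂ e)) (pawEdges P)
  shared-edge-in-M P {Q ∷ _} (here shared) =
    Any.map (λ shared′ → let s∈Q , t∈Q = shared-edge-vertices Q shared′ in here s∈Q , here t∈Q)
            shared
  shared-edge-in-M P (there shared) =
    Any.map (λ (Ms , Mt) → there Ms , there Mt) (shared-edge-in-M P shared)

  -- a lies on every edge of the paw except bc
  paw-meets-M : {F : List (Paw G)} → MaximalFamily G F →
                ∀ {a b c d} → ¬ InM F a → ¬ InM F b → ¬ IsInducedPaw (Adj G) a b c d
  paw-meets-M maximal ¬Ma ¬Mb p =
    All¬⇒¬Any ((¬Ma ∘ proj₁) ∷ (¬Mb ∘ proj₁) ∷ (¬Ma ∘ proj₁) ∷ (¬Ma ∘ proj₁) ∷ [])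
              (shared-edge-in-M P (maximal P))
    where P = paw _ _ _ _ p

module CompleteMultipartiteComponent
  {n : ℕ} {G : Graph (Fin n)} {F : List (Paw G)} (maximal : MaximalFamily G F)
  {x : Fin n} (¬Mx : ¬ InM F x) (cmp : IsCompleteMultipartiteOn G (Component G (InM F) x)) where

  private
    M C : Fin n → Set
    M = InM F
    C = Component G M x

    parts : ℕ
    parts = proj₁ cmp

    3≤parts : 3 ≤ parts
    3≤parts = proj₁ (proj₂ cmp)

    colour : Fin n → Fin parts
    colour = proj₁ (proj₂ (proj₂ cmp))

    colour-onto : ∀ i → ∃ λ w → C w × colour w ≡ i
    colour-onto = proj₁ (proj₂ (proj₂ (proj₂ cmp)))

    adj⇒colours-≢ : ∀ {u v} → C u → C v → Adj G u v → colour u ≢ colour v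
    adj⇒colours-≢ Cu Cv = proj₁ (proj₂ (proj₂ (proj₂ (proj₂ cmp))) _ _ Cu Cv)

    colours-≢⇒adj : ∀ {u v} → C u → C v → colour u ≢ colour v → Adj G u v
    colours-≢⇒adj Cu Cv = proj₂ (proj₂ (proj₂ (proj₂ (proj₂ cmp))) _ _ Cu Cv)

    component-step : ∀ {u w} → C u → ¬ M w → Adj G u w → C w
    component-step (¬Mu , path) ¬Mw uw = ¬Mw , path ◅◅ ((¬Mu , ¬Mw , uw) ◅ ε)

    part-colour : ∀ {u} → Part G M x u → colour u ≡ colour x
    part-colour (Cu , ¬xu) =
      decidable-stable (colour _ Fin.≟ colour x) (¬xu ∘ colours-≢⇒adj (¬Mx , ε) Cu ∘ ≢-sym)

    adj-other-part : ∀ {u y} → Part G M x u → C y → colour x ≢ colour y → Adj G u y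
    adj-other-part pu@(Cu , _) Cy x≢y = colours-≢⇒adj Cu Cy (x≢y ∘ trans (≡.sym (part-colour pu)))

  part-self : Part G M x x
  part-self = (¬Mx , ε) , irrefl G x

  part-independent : ∀ {u v} → Part G M x u → Part G M x v → ¬ Adj G u v
  part-independent pu@(Cu , _) pv@(Cv , _) uv =
    adj⇒colours-≢ Cu Cv uv (trans (part-colour pu) (≡.sym (part-colour pv)))

  -- y and z come from two further parts; whichever of wy, wz are edges, one of the four paws
  -- below has its a and b outside M.
  twin-across-M : ∀ {u v w} → Part G M x u → Part G M x v → M w → Adj G u w → ¬ Adj G v w → ⊥
  twin-across-M {u} {v} {w} pu@((¬Mu , _) , _) pv@((¬Mv , _) , _) Mw uw ¬vw
    with two-others 3≤parts (colour x)
  ... | j , l , x≢j , x≢l , j≢l with colour-onto j | colour-onto l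
  ... | y , Cy@(¬My , _) , refl | z , Cz@(¬Mz , _) , refl =
    ¬¬-excluded-middle λ wy? → ¬¬-excluded-middle λ wz? → cases wy? wz?
    where
    outside : ∀ {a b c d} → ¬ M a → ¬ M b → Adj G a b → Adj G b c → Adj G a c → Adj G a d →
              ¬ Adj G b d → ¬ Adj G c d → ⊥
    outside ¬Ma ¬Mb ab bc ac ad ¬bd ¬cd =
      paw-meets-M maximal ¬Ma ¬Mb (induced-paw G ab bc ac ad ¬bd ¬cd)

    uy : Adj G u y
    uy = adj-other-part pu Cy x≢j
    uz : Adj G u z
    uz = adj-other-part pu Cz x≢l
    vy : Adj G v y
    vy = adj-other-part pv Cy x≢j
    vz : Adj G v z
    vz = adj-other-part pv Cz x≢l
    yz : Adj G y z
    yz = colours-≢⇒adj Cy Cz j≢l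

    cases : Dec (Adj G w y) → Dec (Adj G w z) → ⊥
    cases (no ¬wy) (no ¬wz) = outside ¬Mu ¬My uy yz uz uw (¬wy ∘ sym G) (¬wz ∘ sym G)
    cases (yes wy) (no ¬wz) = outside ¬My ¬Mv (sym G vy) vz yz (sym G wy) ¬vw (¬wz ∘ sym G)
    cases (no ¬wy) (yes wz) = outside ¬Mz ¬Mv (sym G vz) vy (sym G yz) (sym G wz) ¬vw (¬wy ∘ sym G)
    cases (yes wy) (yes wz) =
      outside ¬My ¬Mu (sym G uy) uw (sym G wy) (sym G vy) (part-independent pu pv) (¬vw ∘ sym G)

  part-twin : ∀ {u v w} → Part G M x u → Part G M x v → Adj G u w → ¬ ¬ Adj G v w
  part-twin pu@(Cu , _) pv@(Cv , _) uw ¬vw = ¬¬-excluded-middle λ where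
    (yes Mw) → twin-across-M pu pv Mw uw ¬vw
    (no ¬Mw) → let Cw = component-step Cu ¬Mw uw in
      ¬vw (colours-≢⇒adj Cv Cw
        (adj⇒colours-≢ Cu Cw uw ∘ trans (trans (part-colour pu) (≡.sym (part-colour pv)))))

  part-twins : ∀ {u v} → Part G M x u → Part G M x v → Twins G u v
  part-twins pu pv w = part-twin pu pv , part-twin pv pu

module Reduction
  {n : ℕ} (G : Graph (Fin n)) (k : ℕ) (F : List (Paw G)) (maximal : MaximalFamily G F)
  (S : Fin n → Bool) (reduction : IsReduction G k F S)
  {E : List (Fin n × Fin n)} (edges : Edges G E) (|E|≤k : length E ≤ k)
  (touched-kept : ∀ {y} → Touched E y → T (S y)) where

  private
    M : Fin n → Set
    M = InM F

    outside-M : ∀ {x} → ¬ T (S x) → ¬ M x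
    outside-M ¬sx = ¬sx ∘ proj₁ reduction _

  module _ {x : Fin n} (¬sx : ¬ T (S x)) (cmp : IsCompleteMultipartiteOn G (Component G M x)) where
    open CompleteMultipartiteComponent maximal (outside-M ¬sx) cmp

    untouched-in-kept-part : HasSize (λ w → Part G M x w × T (S w)) (suc k) →
                             ∃[ y ] (Part G M x y × T (S y)) × ¬ Touched E y
    untouched-in-kept-part (L , uniq , |L|≡k+1 , members) =
      let y , y∈L , ¬ty =
            find (independent-set-has-untouched Fin._≟_ G edges uniq independent |E|<|L|)
      in y , proj₁ (members y) y∈L , ¬ty
      where
      independent : ∀ {y z} → y ∈ L → z ∈ L → ¬ Adj G y z
      independent y∈L z∈L =
        part-independent (proj₁ (proj₁ (members _) y∈L)) (proj₁ (proj₁ (members _) z∈L))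

      |E|<|L| : length E < length L
      |E|<|L| = subst (length E <_) (≡.sym |L|≡k+1) (s≤s |E|≤k)

    untouched-in-part : ∀ {m} → HasSize (Part G M x) m →
                        ∃[ y ] (Part G M x y × T (S y)) × ¬ Touched E y
    untouched-in-part {m} size
      with m ≤? suc k | proj₂ (proj₂ reduction) x (outside-M ¬sx) cmp m size
    ... | yes m≤k+1 | small , _ = ⊥-elim (¬sx (small m≤k+1 x part-self))
    ... | no m≰k+1 | _ , large = untouched-in-kept-part (large (≰⇒> m≰k+1))

  kept-twin : ∀ x → ¬ ¬ (∃[ x' ] T (S x') × Twins (G ∖ E) x x')
  kept-twin x with T? (S x)
  ... | yes sx = pure (x , sx , twins-refl (G ∖ E))
  ... | no ¬sx = do
    yes cmp ← ¬¬-excluded-middle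
      where no ¬cmp → ⊥-elim (¬sx (proj₁ (proj₂ reduction) x (outside-M ¬sx) ¬cmp))
    (m , size) ← ¬¬-hasSize (Part G M x)
    let y , (y∈part , sy) , ¬ty = untouched-in-part ¬sx cmp size
        open CompleteMultipartiteComponent maximal (outside-M ¬sx) cmp
    pure (y , sy , untouched-twins G E (¬sx ∘ touched-kept) ¬ty (part-twins part-self y∈part))

  pawFree-from-kept : (∀ a b c d → T (S a) → T (S b) → T (S c) → T (S d) →
                        ¬ IsInducedPaw (DeleteEdges G E) a b c d) →
                      PawFree (DeleteEdges G E)
  pawFree-from-kept = pawFree-from-kept-twins Fin._≟_ (G ∖ E) (T ∘ S) kept-twin

induced-yesInstance : (G : Graph V) (S : V → Bool) (k : ℕ) →
                      YesInstance G k → YesInstance (Induced G S) k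
induced-yesInstance {V} G S k (E , edges , |E|≤k , pawFree) =
  E* , agreeOnKept-edges G S agree edges , ≤-trans (restrict-length G S E) |E|≤k ,
  λ a b c d p → paw-transfer (Induced G S ∖ E*) (G ∖ E) id proj₁ (induced-∖-adj G S agree) p
                  (pawFree _ _ _ _)
  where
  E* : List (Σ V (T ∘ S) × Σ V (T ∘ S))
  E* = restrict G S E

  agree : AgreeOnKept G S E* E
  agree = restrict-agrees G S E

reduced-yesInstance : ∀ {n} (G : Graph (Fin n)) (k : ℕ) (F : List (Paw G)) → MaximalFamily G F →
                      (S : Fin n → Bool) → IsReduction G k F S →
                      YesInstance (Induced G S) k → YesInstance G k
reduced-yesInstance {n} G k F maximal S reduction (E* , edges* , |E*|≤k , pawFree*) =
  E , edges , |E|≤k ,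
  Reduction.pawFree-from-kept G k F maximal S reduction edges |E|≤k (embed-touched-kept G S E*)
    λ a b c d sa sb sc sd p →
      paw-transfer (G ∖ E) (Induced G S ∖ E*) proj₁ id
        (λ u w → swap (induced-∖-adj G S agree u w))
        {a , sa} {b , sb} {c , sc} {d , sd} p (pawFree* _ _ _ _)
  where
  E : List (Fin n × Fin n)
  E = embed G S E*

  agree : AgreeOnKept G S E* E
  agree = embed-agrees G S E*

  edges : Edges G E
  edges = All-map⁺ edges*

  |E|≤k : length E ≤ k
  |E|≤k = subst (_≤ k) (≡.sym (length-map _ E*)) |E*|≤k

lemma21 : ∀ {n : ℕ} (G : Graph (Fin n)) (k : ℕ) (F : List (Paw G)) →
              PairwiseEdgeDisjoint F → MaximalFamily G F →
              (S : Fin n → Bool) → IsReduction G k F S →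
              (YesInstance G k → YesInstance (Induced G S) k) ×
              (YesInstance (Induced G S) k → YesInstance G k)
lemma21 G k F _ maximal S reduction =
  induced-yesInstance G S k , reduced-yesInstance G k F maximal S reduction
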